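{- Let $C$, $C'$, $P$, $Q$ be real $n\times n$ matrices. Assume: (i) $PCQ\leq PC'Q$ entrywise; (ii) $C'Qu=\lambda' Qu$ for some nonnegative column vector $u=(u_1,\ldots,u_n)^T$ and some $\lambda'\in\mathbb{R}$; (iii) $v^TPC=\lambda v^TP$ for some nonnegative row vector $v^T=(v_1,\ldots,v_n)$ and some $\lambda\in\mathbb{R}$; (iv) $v^TPQu>0$. Then $\lambda\leq\lambda'$. Moreover, $\lambda=\lambda'$ if and only if $(PC'Q)_{ij}=(PCQ)_{ij}$ for all $1\leq i,j\leq n$ with $v_i\neq 0$ and $u_j\neq 0$. -}

module Defs where

open import Level using (Level; _⊔_; suc)
open import Data.Nat using (ℕ)
open import Data.Fin using (Fin)
open import Data.Product using (Σ; ∃; _×_)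
open import Relation.Nullary using (¬_)
open import Relation.Binary.Structures using (IsTotalOrder)
open import Algebra.Bundles using (CommutativeRing)

-- The standard library has no real numbers, so we quantify over every
-- structure satisfying the axioms of ℝ (any such structure is ℝ up to iso).
record RealNumbers (c ℓ ℓ′ : Level) : Set (suc (c ⊔ ℓ ⊔ ℓ′)) where
  field
    commutativeRing : CommutativeRing c ℓ
  open CommutativeRing commutativeRing public
  infix 4 _≤_ _<_
  field
    _≤_            : Carrier → Carrier → Set ℓ′
    isTotalOrder   : IsTotalOrder _≈_ _≤_
    +-monoˡ-≤      : ∀ {x y} z → x ≤ y → x + z ≤ y + z
    *-nonneg       : ∀ {x y} → 0# ≤ x → 0# ≤ y → 0# ≤ x * y
    0≉1            : ¬ (0# ≈ 1#)
    inverse        : ∀ x → ¬ (x ≈ 0#) → ∃ λ y → x * y ≈ 1#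
  _<_ : Carrier → Carrier → Set (ℓ ⊔ ℓ′)
  x < y = (x ≤ y) × ¬ (x ≈ y)
  IsUpperBound : (Carrier → Set (c ⊔ ℓ ⊔ ℓ′)) → Carrier → Set (c ⊔ ℓ ⊔ ℓ′)
  IsUpperBound S b = ∀ x → S x → x ≤ b
  field
    complete : ∀ (S : Carrier → Set (c ⊔ ℓ ⊔ ℓ′)) →
               (∃ λ x → S x) → (∃ λ b → IsUpperBound S b) →
               ∃ λ s → IsUpperBound S s × (∀ b → IsUpperBound S b → s ≤ b)

module Matrices {c ℓ ℓ′ : Level} (ℝ : RealNumbers c ℓ ℓ′) where
  open RealNumbers ℝ

  Vector : ℕ → Set c
  Vector n = Fin n → Carrier

  Matrix : ℕ → Set c
  Matrix n = Fin n → Fin n → Carrier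

  ∑ : ∀ {n} → (Fin n → Carrier) → Carrier
  ∑ {ℕ.zero}  f = 0#
  ∑ {ℕ.suc n} f = f Fin.zero + ∑ (λ i → f (Fin.suc i))

  _⊗_ : ∀ {n} → Matrix n → Matrix n → Matrix n
  (A ⊗ B) i j = ∑ λ k → A i k * B k j

  _·ᶜ_ : ∀ {n} → Matrix n → Vector n → Vector n
  (A ·ᶜ u) i = ∑ λ k → A i k * u k

  _ʳ·_ : ∀ {n} → Vector n → Matrix n → Vector n
  (v ʳ· A) j = ∑ λ k → v k * A k j

  _∙_ : ∀ {n} → Vector n → Vector n → Carrier
  v ∙ u = ∑ λ k → v k * u k

  infixl 7 _⊗_

{-# OPTIONS --safe #-}
-- The matrix D = PC′Q − PCQ is entrywise nonnegative, and the two eigenvector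
-- equations turn the pairing vᵀDu into (λ′ − λ)·vᵀPQu. Since vᵀPQu > 0 and vᵀDu is
-- a sum of nonnegative terms vᵢDᵢⱼuⱼ, this gives λ ≤ λ′, with equality exactly
-- when every term vanishes, i.e. when Dᵢⱼ = 0 whenever vᵢ ≠ 0 and uⱼ ≠ 0.
-- Constructively, vᵢ ≉ 0 is not decidable, so the converse direction needs that
-- x ≈ 0 is ¬¬-stable; this follows from completeness by an Archimedean argument.
module Submission where

open import Defs
open import Level using (Level; Lift; lift; _⊔_)
open import Data.Nat using (ℕ; zero; suc)
open import Data.Fin using (Fin; zero; suc)
open import Data.Product using (_×_; _,_; proj₁; proj₂; ∃)
open import Data.Sum using (inj₁; inj₂)
open import Data.Empty using (⊥-elim)
open import Relation.Nullary using (¬_)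
open import Relation.Binary.PropositionalEquality as ≡ using (_≡_)
open import Relation.Binary.Structures using (IsTotalOrder)
open import Function.Bundles using (_⇔_; mk⇔; module Equivalence)
import Algebra.Definitions.RawMonoid as RawMonoidDefinitions
import Algebra.Properties.Monoid.Mult as MonoidMultProperties
import Algebra.Properties.Ring as RingProperties
import Algebra.Properties.Semiring.Sum as SemiringSum
import Relation.Binary.Reasoning.Setoid as SetoidReasoning

module OrderedFieldProperties {c ℓ ℓ′ : Level} (ℝ : RealNumbers c ℓ ℓ′) where
  open RealNumbers ℝ
  open IsTotalOrder isTotalOrder public
    using (antisym; total)
    renaming (trans to ≤-trans; reflexive to ≤-reflexive; ≲-respˡ-≈ to ≤-respˡ-≈; ≲-respʳ-≈ to ≤-respʳ-≈)
  open RingProperties ring using (-1*x≈-x; -‿involutive; -‿distribˡ-*; [y-z]x≈yx-zx; x∙y⁻¹≈ε⇒x≈y; x≈y⇒x∙y⁻¹≈ε; -0#≈0#)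
  open RawMonoidDefinitions +-rawMonoid using () renaming (_×_ to _times_)
  open MonoidMultProperties +-monoid using () renaming (×-congʳ to times-congʳ)
  open SetoidReasoning setoid

  +-monoʳ-≤ : ∀ {x y} z → x ≤ y → z + x ≤ z + y
  +-monoʳ-≤ {x} {y} z x≤y = ≤-respˡ-≈ (+-comm x z) (≤-respʳ-≈ (+-comm y z) (+-monoˡ-≤ z x≤y))

  +-cancelˡ-≤ : ∀ {x y} z → z + x ≤ z + y → x ≤ y
  +-cancelˡ-≤ {x} {y} z z+x≤z+y = ≤-respˡ-≈ (cancel x) (≤-respʳ-≈ (cancel y) (+-monoʳ-≤ (- z) z+x≤z+y))
    where
    cancel : ∀ w → - z + (z + w) ≈ w
    cancel w = begin
      - z + (z + w)  ≈⟨ sym (+-assoc (- z) z w) ⟩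
      - z + z + w    ≈⟨ +-congʳ (-‿inverseˡ z) ⟩
      0# + w         ≈⟨ +-identityˡ w ⟩
      w              ∎

  x≤y⇒0≤y-x : ∀ {x y} → x ≤ y → 0# ≤ y - x
  x≤y⇒0≤y-x {x} x≤y = ≤-respˡ-≈ (-‿inverseʳ x) (+-monoˡ-≤ (- x) x≤y)

  x+[y-x]≈y : ∀ x y → x + (y - x) ≈ y
  x+[y-x]≈y x y = begin
    x + (y - x)    ≈⟨ +-congˡ (+-comm y (- x)) ⟩
    x + (- x + y)  ≈⟨ sym (+-assoc x (- x) y) ⟩
    x - x + y      ≈⟨ +-congʳ (-‿inverseʳ x) ⟩
    0# + y         ≈⟨ +-identityˡ y ⟩
    y              ∎

  0≤y-x⇒x≤y : ∀ {x y} → 0# ≤ y - x → x ≤ y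
  0≤y-x⇒x≤y {x} {y} 0≤y-x = ≤-respˡ-≈ (+-identityʳ x) (≤-respʳ-≈ (x+[y-x]≈y x y) (+-monoʳ-≤ x 0≤y-x))

  x≤0⇒0≤-x : ∀ {x} → x ≤ 0# → 0# ≤ - x
  x≤0⇒0≤-x {x} x≤0 = ≤-respʳ-≈ (+-identityˡ (- x)) (x≤y⇒0≤y-x x≤0)

  0≤-x⇒x≤0 : ∀ {x} → 0# ≤ - x → x ≤ 0#
  0≤-x⇒x≤0 {x} 0≤-x = 0≤y-x⇒x≤y (≤-respʳ-≈ (sym (+-identityˡ (- x))) 0≤-x)

  +-nonneg : ∀ {x y} → 0# ≤ x → 0# ≤ y → 0# ≤ x + y
  +-nonneg {x} {y} 0≤x 0≤y = ≤-trans (≤-respʳ-≈ (sym (+-identityˡ y)) 0≤y) (+-monoˡ-≤ y 0≤x)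

  x≤x+y : ∀ {x y} → 0# ≤ y → x ≤ x + y
  x≤x+y {x} 0≤y = ≤-respˡ-≈ (+-identityʳ x) (+-monoʳ-≤ x 0≤y)

  +-nonneg-≈0⇒≈0 : ∀ {x y} → 0# ≤ x → 0# ≤ y → x + y ≈ 0# → x ≈ 0#
  +-nonneg-≈0⇒≈0 {x} 0≤x 0≤y x+y≈0 = antisym (≤-respʳ-≈ x+y≈0 (x≤x+y 0≤y)) 0≤x

  0≤1 : 0# ≤ 1#
  0≤1 with total 0# 1#
  ... | inj₁ 0≤1 = 0≤1
  ... | inj₂ 1≤0 = ≤-respʳ-≈ -1*-1≈1 (*-nonneg (x≤0⇒0≤-x 1≤0) (x≤0⇒0≤-x 1≤0))
    where
    -1*-1≈1 : - 1# * - 1# ≈ 1#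
    -1*-1≈1 = trans (-1*x≈-x (- 1#)) (-‿involutive 1#)

  *≈0⇒≈0 : ∀ {x y} → y ≉ 0# → x * y ≈ 0# → x ≈ 0#
  *≈0⇒≈0 {x} {y} y≉0 xy≈0 with inverse y y≉0
  ... | y⁻¹ , yy⁻¹≈1 = begin
    x              ≈⟨ sym (*-identityʳ x) ⟩
    x * 1#         ≈⟨ *-congˡ (sym yy⁻¹≈1) ⟩
    x * (y * y⁻¹)  ≈⟨ sym (*-assoc x y y⁻¹) ⟩
    x * y * y⁻¹    ≈⟨ *-congʳ xy≈0 ⟩
    0# * y⁻¹       ≈⟨ zeroˡ y⁻¹ ⟩
    0#             ∎

  times-zeroʳ : ∀ k → k times 0# ≈ 0#
  times-zeroʳ zero    = refl
  times-zeroʳ (suc k) = trans (+-identityˡ (k times 0#)) (times-zeroʳ k)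

  ¬¬≈0⇒≤1 : ∀ {x} → ¬ ¬ (x ≈ 0#) → x ≤ 1#
  ¬¬≈0⇒≤1 {x} ¬¬x≈0 with total x 1#
  ... | inj₁ x≤1 = x≤1
  ... | inj₂ 1≤x = ⊥-elim (¬¬x≈0 λ x≈0 → 0≉1 (antisym 0≤1 (≤-respʳ-≈ x≈0 1≤x)))

  -- An Archimedean argument: the multiples of x are bounded by 1, and their
  -- supremum s is also bounded by s - x.
  ¬¬≈0⇒≤0 : ∀ {x} → ¬ ¬ (x ≈ 0#) → x ≤ 0#
  ¬¬≈0⇒≤0 {x} ¬¬x≈0 = 0≤-x⇒x≤0 (+-cancelˡ-≤ s (≤-respˡ-≈ (sym (+-identityʳ s)) s≤s-x))
    where
    Multiple : Carrier → Set (c ⊔ ℓ ⊔ ℓ′)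
    Multiple y = Lift (c ⊔ ℓ′) (∃ λ k → y ≈ k times x)

    multiple-≤1 : IsUpperBound Multiple 1#
    multiple-≤1 y (lift (k , y≈kx)) =
      ¬¬≈0⇒≤1 λ y≉0 → ¬¬x≈0 λ x≈0 → y≉0 (trans y≈kx (trans (times-congʳ k x≈0) (times-zeroʳ k)))

    supremum : ∃ λ s → IsUpperBound Multiple s × (∀ b → IsUpperBound Multiple b → s ≤ b)
    supremum = complete Multiple (0# , lift (0 , refl)) (1# , multiple-≤1)

    s : Carrier
    s = proj₁ supremum

    multiple-≤s-x : IsUpperBound Multiple (s - x)
    multiple-≤s-x y (lift (k , y≈kx)) = ≤-respˡ-≈ (sym y≈kx)
      (+-cancelˡ-≤ x (≤-respʳ-≈ (sym (x+[y-x]≈y x s)) (proj₁ (proj₂ supremum) _ (lift (suc k , refl)))))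

    s≤s-x : s ≤ s - x
    s≤s-x = proj₂ (proj₂ supremum) (s - x) multiple-≤s-x

  ≈0-stable : ∀ {x} → ¬ ¬ (x ≈ 0#) → x ≈ 0#
  ≈0-stable {x} ¬¬x≈0 = antisym (¬¬≈0⇒≤0 ¬¬x≈0)
    (≤-respʳ-≈ (-‿involutive x) (x≤0⇒0≤-x (¬¬≈0⇒≤0 λ -x≉0 → ¬¬x≈0 λ x≈0 → -x≉0 (trans (-‿cong x≈0) -0#≈0#))))

  *≈0⇔ : ∀ {x y} → x * y ≈ 0# ⇔ (x ≉ 0# → y ≈ 0#)
  *≈0⇔ {x} {y} = mk⇔
    (λ xy≈0 x≉0 → *≈0⇒≈0 x≉0 (trans (*-comm y x) xy≈0))
    (λ y≈0-if-x≉0 → ≈0-stable λ xy≉0 →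
      let x≉0 : x ≉ 0#
          x≉0 x≈0 = xy≉0 (trans (*-congʳ x≈0) (zeroˡ y))
      in xy≉0 (trans (*-congˡ (y≈0-if-x≉0 x≉0)) (zeroʳ x)))

  *-cancelʳ-≈ : ∀ {x y z} → z ≉ 0# → x * z ≈ y * z → x ≈ y
  *-cancelʳ-≈ {x} {y} {z} z≉0 xz≈yz =
    x∙y⁻¹≈ε⇒x≈y x y (*≈0⇒≈0 z≉0 (trans ([y-z]x≈yx-zx z x y) (x≈y⇒x∙y⁻¹≈ε xz≈yz)))

  *-cancelʳ-nonneg : ∀ {x z} → 0# < z → 0# ≤ x * z → 0# ≤ x
  *-cancelʳ-nonneg {x} {z} (0≤z , 0≉z) 0≤xz with total x 0#
  ... | inj₂ 0≤x = 0≤x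
  ... | inj₁ x≤0 = ≤-reflexive (sym (*≈0⇒≈0 (λ z≈0 → 0≉z (sym z≈0)) (antisym xz≤0 0≤xz)))
    where
    xz≤0 : x * z ≤ 0#
    xz≤0 = 0≤-x⇒x≤0 (≤-respʳ-≈ (sym (-‿distribˡ-* x z)) (*-nonneg (x≤0⇒0≤-x x≤0) 0≤z))

  *-cancelʳ-≤ : ∀ {x y z} → 0# < z → x * z ≤ y * z → x ≤ y
  *-cancelʳ-≤ {x} {y} {z} 0<z xz≤yz =
    0≤y-x⇒x≤y (*-cancelʳ-nonneg 0<z (≤-respʳ-≈ (sym ([y-z]x≈yx-zx z y x)) (x≤y⇒0≤y-x xz≤yz)))

module MatrixProperties {c ℓ ℓ′ : Level} (ℝ : RealNumbers c ℓ ℓ′) where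
  open RealNumbers ℝ hiding (zero)
  open Matrices ℝ
  open OrderedFieldProperties ℝ
  open RingProperties ring using (-1*x≈-x; x[y-z]≈xy-xz; [y-z]x≈yx-zx; x∙y⁻¹≈ε⇒x≈y; x≈y⇒x∙y⁻¹≈ε)
  open SemiringSum semiring using (sum; sum-cong-≋; sum-replicate-zero; *-distribˡ-sum)
    renaming (∑-comm to sum-comm; ∑-distrib-+ to sum-distrib-+)
  open SetoidReasoning setoid

  ∑≡sum : ∀ {n} (f : Fin n → Carrier) → ∑ f ≡ sum f
  ∑≡sum {zero}  f = ≡.refl
  ∑≡sum {suc n} f = ≡.cong (f zero +_) (∑≡sum (λ i → f (suc i)))

  ∑≈sum : ∀ {n} (f : Fin n → Carrier) → ∑ f ≈ sum f
  ∑≈sum f = reflexive (∑≡sum f)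

  ∑-cong : ∀ {n} {f g : Fin n → Carrier} → (∀ i → f i ≈ g i) → ∑ f ≈ ∑ g
  ∑-cong {f = f} {g} f≈g = begin
    ∑ f    ≈⟨ ∑≈sum f ⟩
    sum f  ≈⟨ sum-cong-≋ f≈g ⟩
    sum g  ≈⟨ ∑≈sum g ⟨
    ∑ g    ∎

  ∑-zero : ∀ {n} {f : Fin n → Carrier} → (∀ i → f i ≈ 0#) → ∑ f ≈ 0#
  ∑-zero {n} f≈0 = trans (∑-cong f≈0) (trans (∑≈sum {n} (λ _ → 0#)) (sum-replicate-zero n))

  ∑-comm : ∀ {m n} (f : Fin m → Fin n → Carrier) →
           ∑ (λ i → ∑ (λ j → f i j)) ≈ ∑ (λ j → ∑ (λ i → f i j))
  ∑-comm f = begin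
    ∑ (λ i → ∑ (λ j → f i j))      ≈⟨ ∑-cong (λ i → ∑≈sum (f i)) ⟩
    ∑ (λ i → sum (λ j → f i j))    ≈⟨ ∑≈sum (λ i → sum (f i)) ⟩
    sum (λ i → sum (λ j → f i j))  ≈⟨ sum-comm f ⟩
    sum (λ j → sum (λ i → f i j))  ≈⟨ ∑≈sum (λ j → sum (λ i → f i j)) ⟨
    ∑ (λ j → sum (λ i → f i j))    ≈⟨ ∑-cong (λ j → ∑≈sum (λ i → f i j)) ⟨
    ∑ (λ j → ∑ (λ i → f i j))      ∎

  *-distribˡ-∑ : ∀ {n} x (f : Fin n → Carrier) → x * ∑ f ≈ ∑ (λ i → x * f i)
  *-distribˡ-∑ x f = begin
    x * ∑ f                ≈⟨ *-congˡ (∑≈sum f) ⟩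
    x * sum f              ≈⟨ *-distribˡ-sum x f ⟩
    sum (λ i → x * f i)    ≈⟨ ∑≈sum (λ i → x * f i) ⟨
    ∑ (λ i → x * f i)      ∎

  *-distribʳ-∑ : ∀ {n} x (f : Fin n → Carrier) → ∑ f * x ≈ ∑ (λ i → f i * x)
  *-distribʳ-∑ x f = trans (*-comm (∑ f) x) (trans (*-distribˡ-∑ x f) (∑-cong λ i → *-comm x (f i)))

  ∑-distrib-- : ∀ {n} (f g : Fin n → Carrier) → ∑ (λ i → f i - g i) ≈ ∑ f - ∑ g
  ∑-distrib-- f g = begin
    ∑ (λ i → f i - g i)           ≈⟨ ∑≈sum (λ i → f i - g i) ⟩
    sum (λ i → f i - g i)         ≈⟨ sum-distrib-+ f (λ i → - g i) ⟩
    sum f + sum (λ i → - g i)     ≈⟨ +-cong (∑≈sum f) (∑≈sum (λ i → - g i)) ⟨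
    ∑ f + ∑ (λ i → - g i)         ≈⟨ +-congˡ (∑-cong λ i → -1*x≈-x (g i)) ⟨
    ∑ f + ∑ (λ i → - 1# * g i)    ≈⟨ +-congˡ (*-distribˡ-∑ (- 1#) g) ⟨
    ∑ f + - 1# * ∑ g              ≈⟨ +-congˡ (-1*x≈-x (∑ g)) ⟩
    ∑ f - ∑ g                     ∎

  ∑-nonneg : ∀ {n} {f : Fin n → Carrier} → (∀ i → 0# ≤ f i) → 0# ≤ ∑ f
  ∑-nonneg {zero}  f≥0 = ≤-reflexive refl
  ∑-nonneg {suc n} f≥0 = +-nonneg (f≥0 zero) (∑-nonneg λ i → f≥0 (suc i))

  ∑-nonneg-≈0⇒≈0 : ∀ {n} {f : Fin n → Carrier} → (∀ i → 0# ≤ f i) → ∑ f ≈ 0# → ∀ i → f i ≈ 0#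
  ∑-nonneg-≈0⇒≈0 {suc n} f≥0 ∑f≈0 zero =
    +-nonneg-≈0⇒≈0 (f≥0 zero) (∑-nonneg λ i → f≥0 (suc i)) ∑f≈0
  ∑-nonneg-≈0⇒≈0 {suc n} f≥0 ∑f≈0 (suc i) =
    ∑-nonneg-≈0⇒≈0 (λ i → f≥0 (suc i))
      (+-nonneg-≈0⇒≈0 (∑-nonneg λ i → f≥0 (suc i)) (f≥0 zero) (trans (+-comm _ _) ∑f≈0)) i

  ∙-congˡ : ∀ {n} {w w′ : Vector n} (x : Vector n) → (∀ i → w i ≈ w′ i) → w ∙ x ≈ w′ ∙ x
  ∙-congˡ x w≈w′ = ∑-cong λ i → *-congʳ (w≈w′ i)

  ∙-congʳ : ∀ {n} (w : Vector n) {x x′ : Vector n} → (∀ i → x i ≈ x′ i) → w ∙ x ≈ w ∙ x′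
  ∙-congʳ w x≈x′ = ∑-cong λ i → *-congˡ (x≈x′ i)

  ∙-*ˡ : ∀ {n} a (w x : Vector n) → (λ i → a * w i) ∙ x ≈ a * (w ∙ x)
  ∙-*ˡ a w x = trans (∑-cong λ i → *-assoc a (w i) (x i)) (sym (*-distribˡ-∑ a (λ i → w i * x i)))

  ∙-*ʳ : ∀ {n} a (w x : Vector n) → w ∙ (λ i → a * x i) ≈ a * (w ∙ x)
  ∙-*ʳ a w x = trans (∑-cong λ i → x*[a*y]≈a*x*y (w i) (x i)) (∙-*ˡ a w x)
    where
    x*[a*y]≈a*x*y : ∀ x y → x * (a * y) ≈ a * x * y
    x*[a*y]≈a*x*y x y = trans (sym (*-assoc x a y)) (*-congʳ (*-comm x a))

  ∙-distrib-- : ∀ {n} (w x y : Vector n) → w ∙ (λ i → x i - y i) ≈ w ∙ x - w ∙ y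
  ∙-distrib-- w x y = trans (∑-cong λ i → x[y-z]≈xy-xz (w i) (x i) (y i))
    (∑-distrib-- (λ i → w i * x i) (λ i → w i * y i))

  ·ᶜ-distrib-- : ∀ {n} (A B : Matrix n) (u : Vector n) i →
                 ((λ i j → A i j - B i j) ·ᶜ u) i ≈ (A ·ᶜ u) i - (B ·ᶜ u) i
  ·ᶜ-distrib-- A B u i = trans (∑-cong λ j → [y-z]x≈yx-zx (u j) (A i j) (B i j))
    (∑-distrib-- (λ j → A i j * u j) (λ j → B i j * u j))

  ⊗-·ᶜ-assoc : ∀ {n} (A B : Matrix n) (u : Vector n) i → ((A ⊗ B) ·ᶜ u) i ≈ (A ·ᶜ (B ·ᶜ u)) i
  ⊗-·ᶜ-assoc A B u i = begin
    ∑ (λ k → ∑ (λ m → A i m * B m k) * u k)    ≈⟨ ∑-cong (λ k → *-distribʳ-∑ (u k) λ m → A i m * B m k) ⟩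
    ∑ (λ k → ∑ (λ m → A i m * B m k * u k))    ≈⟨ ∑-comm (λ k m → A i m * B m k * u k) ⟩
    ∑ (λ m → ∑ (λ k → A i m * B m k * u k))    ≈⟨ ∑-cong (λ m → ∑-cong λ k → *-assoc (A i m) (B m k) (u k)) ⟩
    ∑ (λ m → ∑ (λ k → A i m * (B m k * u k)))  ≈⟨ ∑-cong (λ m → *-distribˡ-∑ (A i m) λ k → B m k * u k) ⟨
    ∑ (λ m → A i m * ∑ (λ k → B m k * u k))    ∎

  ∙-·ᶜ-assoc : ∀ {n} (v : Vector n) (A : Matrix n) (u : Vector n) → v ∙ (A ·ᶜ u) ≈ (v ʳ· A) ∙ u
  ∙-·ᶜ-assoc v A u = begin
    ∑ (λ i → v i * ∑ (λ k → A i k * u k))    ≈⟨ ∑-cong (λ i → *-distribˡ-∑ (v i) λ k → A i k * u k) ⟩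
    ∑ (λ i → ∑ (λ k → v i * (A i k * u k)))  ≈⟨ ∑-comm (λ i k → v i * (A i k * u k)) ⟩
    ∑ (λ k → ∑ (λ i → v i * (A i k * u k)))  ≈⟨ ∑-cong (λ k → ∑-cong λ i → *-assoc (v i) (A i k) (u k)) ⟨
    ∑ (λ k → ∑ (λ i → v i * A i k * u k))    ≈⟨ ∑-cong (λ k → *-distribʳ-∑ (u k) λ i → v i * A i k) ⟨
    ∑ (λ k → ∑ (λ i → v i * A i k) * u k)    ∎

  ∙-⊗⊗-·ᶜ : ∀ {n} (P C Q : Matrix n) (u v : Vector n) →
            v ∙ ((P ⊗ C ⊗ Q) ·ᶜ u) ≈ (v ʳ· P) ∙ (C ·ᶜ (Q ·ᶜ u))
  ∙-⊗⊗-·ᶜ P C Q u v = begin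
    v ∙ ((P ⊗ C ⊗ Q) ·ᶜ u)      ≈⟨ ∙-congʳ v (⊗-·ᶜ-assoc (P ⊗ C) Q u) ⟩
    v ∙ ((P ⊗ C) ·ᶜ (Q ·ᶜ u))   ≈⟨ ∙-congʳ v (⊗-·ᶜ-assoc P C (Q ·ᶜ u)) ⟩
    v ∙ (P ·ᶜ (C ·ᶜ (Q ·ᶜ u)))  ≈⟨ ∙-·ᶜ-assoc v P (C ·ᶜ (Q ·ᶜ u)) ⟩
    (v ʳ· P) ∙ (C ·ᶜ (Q ·ᶜ u))  ∎

  ∙-⊗⊗-·ᶜ-eigenʳ : ∀ {n} (P C Q : Matrix n) (u v : Vector n) {μ} →
                   (∀ i → (C ·ᶜ (Q ·ᶜ u)) i ≈ μ * (Q ·ᶜ u) i) →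
                   v ∙ ((P ⊗ C ⊗ Q) ·ᶜ u) ≈ μ * ((v ʳ· P) ∙ (Q ·ᶜ u))
  ∙-⊗⊗-·ᶜ-eigenʳ P C Q u v {μ} eigen = begin
    v ∙ ((P ⊗ C ⊗ Q) ·ᶜ u)              ≈⟨ ∙-⊗⊗-·ᶜ P C Q u v ⟩
    (v ʳ· P) ∙ (C ·ᶜ (Q ·ᶜ u))          ≈⟨ ∙-congʳ (v ʳ· P) eigen ⟩
    (v ʳ· P) ∙ (λ i → μ * (Q ·ᶜ u) i)   ≈⟨ ∙-*ʳ μ (v ʳ· P) (Q ·ᶜ u) ⟩
    μ * ((v ʳ· P) ∙ (Q ·ᶜ u))           ∎

  ∙-⊗⊗-·ᶜ-eigenˡ : ∀ {n} (P C Q : Matrix n) (u v : Vector n) {μ} →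
                   (∀ j → ((v ʳ· P) ʳ· C) j ≈ μ * (v ʳ· P) j) →
                   v ∙ ((P ⊗ C ⊗ Q) ·ᶜ u) ≈ μ * ((v ʳ· P) ∙ (Q ·ᶜ u))
  ∙-⊗⊗-·ᶜ-eigenˡ P C Q u v {μ} eigen = begin
    v ∙ ((P ⊗ C ⊗ Q) ·ᶜ u)              ≈⟨ ∙-⊗⊗-·ᶜ P C Q u v ⟩
    (v ʳ· P) ∙ (C ·ᶜ (Q ·ᶜ u))          ≈⟨ ∙-·ᶜ-assoc (v ʳ· P) C (Q ·ᶜ u) ⟩
    ((v ʳ· P) ʳ· C) ∙ (Q ·ᶜ u)          ≈⟨ ∙-congˡ (Q ·ᶜ u) eigen ⟩
    (λ j → μ * (v ʳ· P) j) ∙ (Q ·ᶜ u)   ≈⟨ ∙-*ˡ μ (v ʳ· P) (Q ·ᶜ u) ⟩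
    μ * ((v ʳ· P) ∙ (Q ·ᶜ u))           ∎

  module _ {n} {u v : Vector n} (v≥0 : ∀ i → 0# ≤ v i) (u≥0 : ∀ j → 0# ≤ u j) where

    ∙-·ᶜ-nonneg : ∀ {D : Matrix n} → (∀ i j → 0# ≤ D i j) → 0# ≤ v ∙ (D ·ᶜ u)
    ∙-·ᶜ-nonneg D≥0 = ∑-nonneg λ i → *-nonneg (v≥0 i) (∑-nonneg λ j → *-nonneg (D≥0 i j) (u≥0 j))

    ∙-·ᶜ-≈0⇔ : ∀ {D : Matrix n} → (∀ i j → 0# ≤ D i j) →
               v ∙ (D ·ᶜ u) ≈ 0# ⇔ (∀ i j → v i ≉ 0# → u j ≉ 0# → D i j ≈ 0#)
    ∙-·ᶜ-≈0⇔ {D} D≥0 = mk⇔ to from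
      where
      Du≥0 : ∀ i j → 0# ≤ D i j * u j
      Du≥0 i j = *-nonneg (D≥0 i j) (u≥0 j)

      to : v ∙ (D ·ᶜ u) ≈ 0# → ∀ i j → v i ≉ 0# → u j ≉ 0# → D i j ≈ 0#
      to vDu≈0 i j vᵢ≉0 uⱼ≉0 = *≈0⇒≈0 uⱼ≉0 (∑-nonneg-≈0⇒≈0 (Du≥0 i) row≈0 j)
        where
        row≈0 : (D ·ᶜ u) i ≈ 0#
        row≈0 = Equivalence.to *≈0⇔
          (∑-nonneg-≈0⇒≈0 (λ i → *-nonneg (v≥0 i) (∑-nonneg (Du≥0 i))) vDu≈0 i) vᵢ≉0

      from : (∀ i j → v i ≉ 0# → u j ≉ 0# → D i j ≈ 0#) → v ∙ (D ·ᶜ u) ≈ 0#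
      from D≈0 = ∑-zero λ i → Equivalence.from *≈0⇔ λ vᵢ≉0 → ∑-zero λ j →
        trans (*-comm (D i j) (u j)) (Equivalence.from *≈0⇔ (D≈0 i j vᵢ≉0))

    module _ {A B : Matrix n} (B≤A : ∀ i j → B i j ≤ A i j) where

      private
        D : Matrix n
        D i j = A i j - B i j

        D≥0 : ∀ i j → 0# ≤ D i j
        D≥0 i j = x≤y⇒0≤y-x (B≤A i j)

        ∙-·ᶜ-D : v ∙ (D ·ᶜ u) ≈ v ∙ (A ·ᶜ u) - v ∙ (B ·ᶜ u)
        ∙-·ᶜ-D = trans (∙-congʳ v (·ᶜ-distrib-- A B u)) (∙-distrib-- v (A ·ᶜ u) (B ·ᶜ u))

      ∙-·ᶜ-mono-≤ : v ∙ (B ·ᶜ u) ≤ v ∙ (A ·ᶜ u)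
      ∙-·ᶜ-mono-≤ = 0≤y-x⇒x≤y (≤-respʳ-≈ ∙-·ᶜ-D (∙-·ᶜ-nonneg D≥0))

      ∙-·ᶜ-≈⇔ : v ∙ (A ·ᶜ u) ≈ v ∙ (B ·ᶜ u) ⇔ (∀ i j → v i ≉ 0# → u j ≉ 0# → A i j ≈ B i j)
      ∙-·ᶜ-≈⇔ = mk⇔
        (λ vAu≈vBu i j vᵢ≉0 uⱼ≉0 → x∙y⁻¹≈ε⇒x≈y (A i j) (B i j)
          (Equivalence.to (∙-·ᶜ-≈0⇔ D≥0) (trans ∙-·ᶜ-D (x≈y⇒x∙y⁻¹≈ε vAu≈vBu)) i j vᵢ≉0 uⱼ≉0))
        (λ A≈B → x∙y⁻¹≈ε⇒x≈y _ _ (trans (sym ∙-·ᶜ-D)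
          (Equivalence.from (∙-·ᶜ-≈0⇔ D≥0) λ i j vᵢ≉0 uⱼ≉0 → x≈y⇒x∙y⁻¹≈ε (A≈B i j vᵢ≉0 uⱼ≉0))))

lemma3p1 : ∀ {c ℓ ℓ′ : Level} (ℝ : RealNumbers c ℓ ℓ′) →
  let open RealNumbers ℝ
      open Matrices ℝ
  in ∀ (n : ℕ) (C C′ P Q : Matrix n) (u v : Vector n) (λ₀ λ′ : Carrier) →
     (∀ i j → (P ⊗ C ⊗ Q) i j ≤ (P ⊗ C′ ⊗ Q) i j) →
     (∀ j → 0# ≤ u j) →
     (∀ i → (C′ ·ᶜ (Q ·ᶜ u)) i ≈ λ′ * (Q ·ᶜ u) i) →
     (∀ i → 0# ≤ v i) →
     (∀ j → ((v ʳ· P) ʳ· C) j ≈ λ₀ * (v ʳ· P) j) →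
     0# < (v ʳ· P) ∙ (Q ·ᶜ u) →
     (λ₀ ≤ λ′) ×
     ((λ₀ ≈ λ′) ⇔ (∀ (i j : Fin n) → ¬ (v i ≈ 0#) → ¬ (u j ≈ 0#) →
                     (P ⊗ C′ ⊗ Q) i j ≈ (P ⊗ C ⊗ Q) i j))
lemma3p1 ℝ n C C′ P Q u v λ₀ λ′ PCQ≤PC′Q u≥0 C′-eigen v≥0 C-eigen 0<s =
    *-cancelʳ-≤ 0<s (≤-respˡ-≈ vPCQu≈λ₀s (≤-respʳ-≈ vPC′Qu≈λ′s (∙-·ᶜ-mono-≤ v≥0 u≥0 PCQ≤PC′Q)))
  , mk⇔
      (λ λ₀≈λ′ → Equivalence.to (∙-·ᶜ-≈⇔ v≥0 u≥0 PCQ≤PC′Q)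
        (trans vPC′Qu≈λ′s (trans (*-congʳ (sym λ₀≈λ′)) (sym vPCQu≈λ₀s))))
      (λ PC′Q≈PCQ → *-cancelʳ-≈ (λ s≈0 → proj₂ 0<s (sym s≈0))
        (trans (sym vPCQu≈λ₀s) (trans (sym (Equivalence.from (∙-·ᶜ-≈⇔ v≥0 u≥0 PCQ≤PC′Q) PC′Q≈PCQ)) vPC′Qu≈λ′s)))
  where
  open RealNumbers ℝ
  open Matrices ℝ
  open OrderedFieldProperties ℝ
  open MatrixProperties ℝ

  vPCQu≈λ₀s : v ∙ ((P ⊗ C ⊗ Q) ·ᶜ u) ≈ λ₀ * ((v ʳ· P) ∙ (Q ·ᶜ u))
  vPCQu≈λ₀s = ∙-⊗⊗-·ᶜ-eigenˡ P C Q u v C-eigen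

  vPC′Qu≈λ′s : v ∙ ((P ⊗ C′ ⊗ Q) ·ᶜ u) ≈ λ′ * ((v ʳ· P) ∙ (Q ·ᶜ u))
  vPC′Qu≈λ′s = ∙-⊗⊗-·ᶜ-eigenʳ P C′ Q u v C′-eigen
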